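{- Let $k \ge 0$ be an integer and let $G=(V,E)$ be a finite simple graph with no isolated vertices and with maximum degree $\Delta \ge 2$, such that $|V| \ge 5k$. If $|V| \ge 4k+\Delta$, then $\mu(G) \ge k$, i.e. $(G,k)$ is a Yes-instance of $k$-LCP.
   Context: For a graph $G=(V,E)$ and a 2-coloring $f: V \to \{\text{red},\text{blue}\}$, an edge is called red (resp. blue) if both of its end-vertices are red (resp. blue). Let $r'_f$ and $b'_f$ denote the numbers of red and blue edges, $\mu_f(G) = \min\{r'_f, b'_f\}$, and $\mu(G)$ the maximum of $\mu_f(G)$ over all 2-colorings $f$ of $V$. The problem $k$-LCP ($k$-Load Coloring Problem) takes as input a graph $G$ and an integer $k$ (the parameter) and asks whether $\mu(G) \ge k$. -}

module Defs where

open import Data.Nat using (ℕ; zero; suc; _+_; _*_; _≤_; _<_; _⊓_)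
open import Data.Bool using (Bool; true; false; _∧_; T; not)
open import Data.Fin using (Fin; toℕ)
open import Data.List using (List; filter; length; allFin; concatMap; map)
open import Data.Product using (_×_; _,_; proj₁; proj₂; ∃)
open import Relation.Binary.PropositionalEquality using (_≡_)
open import Relation.Nullary using (¬_)
open import Relation.Nullary.Decidable using (does)
open import Data.Nat using (_<?_)

record Graph (n : ℕ) : Set where
  field
    adj    : Fin n → Fin n → Bool
    sym    : ∀ i j → adj i j ≡ adj j i
    irrefl : ∀ i → adj i i ≡ false
open Graph public

degree : ∀ {n} → Graph n → Fin n → ℕ
degree G v = length (filter (λ w → T? (adj G v w)) (allFin _))
  where
  open import Data.Bool.Properties using (T?)

NoIsolated : ∀ {n} → Graph n → Set
NoIsolated {n} G = ∀ (v : Fin n) → 1 ≤ degree G v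

IsMaxDegree : ∀ {n} → Graph n → ℕ → Set
IsMaxDegree {n} G Δ = (∀ (v : Fin n) → degree G v ≤ Δ) × ∃ (λ (v : Fin n) → degree G v ≡ Δ)

pairs : ∀ n → List (Fin n × Fin n)
pairs n = filter (λ p → toℕ (proj₁ p) <? toℕ (proj₂ p))
                 (concatMap (λ i → map (λ j → (i , j)) (allFin n)) (allFin n))

-- a 2-colouring: true = red, false = blue
Coloring : ℕ → Set
Coloring n = Fin n → Bool

edgesWithin : ∀ {n} → Graph n → (Fin n → Bool) → ℕ
edgesWithin {n} G c =
  length (filter (λ p → T? (adj G (proj₁ p) (proj₂ p) ∧ c (proj₁ p) ∧ c (proj₂ p))) (pairs n))
  where
  open import Data.Bool.Properties using (T?)

redEdges : ∀ {n} → Graph n → Coloring n → ℕ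
redEdges G f = edgesWithin G f

blueEdges : ∀ {n} → Graph n → Coloring n → ℕ
blueEdges G f = edgesWithin G (λ v → not (f v))

μf : ∀ {n} → Graph n → Coloring n → ℕ
μf G f = redEdges G f ⊓ blueEdges G f

-- μ(G) ≥ k  (μ(G) is the maximum of μ_f(G) over the finitely many colourings,
-- so μ(G) ≥ k iff some colouring f has μ_f(G) ≥ k)
μ≥ : ∀ {n} → Graph n → ℕ → Set
μ≥ G k = ∃ (λ f → k ≤ μf G f)

module Submission where

-- Fix a neighbour p v of every vertex. For a vertex set S, colour red its closure: S together with
-- every vertex all of whose neighbours lie in S. Then every blue vertex has a blue neighbour, and every
-- vertex of S with a neighbour in S is red with a red neighbour. Grow S from ∅ by adding 0, p 0, 1, p 1, …
-- one vertex at a time; every vertex of S keeps a neighbour in S or in the vertex x added next, so one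
-- step can only add to the closure vertices of the closed neighbourhood of x (at most 1 + Δ of them)
-- beyond the red vertices that already had a red neighbour. At the first S where 2k red vertices have a
-- red neighbour, the red class therefore has at most 2k + Δ vertices, leaving at least n − 2k − Δ ≥ 2k
-- blue ones. By the handshake lemma, 2k vertices each with a neighbour of their colour span ≥ k edges.

open import Defs hiding (sym)
open import Data.Bool.Base using (Bool; true; false; _∧_; _∨_; not; T)
open import Data.Bool.Properties using (T?; T-∧; T-∨; ∧-comm)
open import Data.Empty using (⊥-elim)
open import Data.Fin.Base using (Fin; zero; suc; toℕ; fromℕ<)
open import Data.Fin.Properties using (_≟_; any?; all?; ¬∀⟶∃¬; toℕ-injective; toℕ<n; toℕ-fromℕ<)
open import Data.List.Base using (List; []; _∷_; _++_; filter; length; allFin; concatMap; map; tabulate)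
open import Data.List.Properties using (filter-++; length-++; map-tabulate)
open import Data.Nat.Base using (ℕ; zero; suc; _+_; _*_; _≤_; _<_; z≤n; s≤s; s≤s⁻¹)
open import Data.Nat.Properties
  using (_<?_; _≤?_; <-cmp; ≤-refl; ≤-trans; ≤-reflexive; ≤-antisym; <⇒≤; <-≤-trans; <⇒≱; ≮⇒≥; ≰⇒>; ≤⇒≯;
         n≤1+n; m<1+n⇒m<n∨m≡n; m≤m+n; +-mono-≤; +-monoˡ-≤; +-monoʳ-≤; +-cancelʳ-≤; *-cancelˡ-≤;
         +-assoc; +-identityʳ; +-suc; *-distribʳ-+; ⊓-glb; +-0-commutativeMonoid; module ≤-Reasoning)
open import Algebra.Properties.CommutativeMonoid.Sum +-0-commutativeMonoid
  using (sum; sum-syntax; sum-cong-≗; sum-remove; sum-replicate-zero; ∑-distrib-+; ∑-comm)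
open import Data.Product using (_×_; _,_; proj₁; proj₂; ∃)
open import Data.Sum using (_⊎_; inj₁; inj₂)
open import Function.Bundles using (module Equivalence)
open Equivalence using (to; from)
open import Function.Base using (_∘_)
open import Level using (Level)
open import Relation.Binary.Definitions using (tri<; tri≈; tri>)
open import Relation.Binary.PropositionalEquality using (_≡_; refl; sym; trans; cong; cong₂; subst; module ≡-Reasoning)
open import Relation.Nullary using (¬_; contradiction)
open import Relation.Nullary.Decidable using (yes; no; does; ⌊_⌋; _×-dec_; _⊎-dec_; _→-dec_; dec-true; dec-false; toWitness; fromWitness)
open import Relation.Unary using (Pred; Decidable)

𝟙 : Bool → ℕ
𝟙 true  = 1
𝟙 false = 0

T⇒𝟙≡1 : ∀ {b} → T b → 𝟙 b ≡ 1
T⇒𝟙≡1 {true} _ = refl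

¬T⇒T-not : ∀ {b} → ¬ T b → T (not b)
¬T⇒T-not {false} _    = _
¬T⇒T-not {true}  ¬T = ¬T _

T-not⇒¬T : ∀ {b} → T (not b) → ¬ T b
T-not⇒¬T {false} _ ()

module _ {a p : Level} {A : Set a} {P : Pred A p} (P? : Decidable P) where

  length-filter-++ : ∀ xs ys → length (filter P? (xs ++ ys)) ≡ length (filter P? xs) + length (filter P? ys)
  length-filter-++ xs ys = trans (cong length (filter-++ P? xs ys)) (length-++ (filter P? xs))

  length-filter-tabulate : ∀ {n} (f : Fin n → A) → length (filter P? (tabulate f)) ≡ ∑[ i < n ] 𝟙 (does (P? (f i)))
  length-filter-tabulate {zero}  f = refl
  length-filter-tabulate {suc n} f with does (P? (f zero))
  ... | true  = cong suc (length-filter-tabulate (f ∘ suc))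
  ... | false = length-filter-tabulate (f ∘ suc)

  length-filter-concatMap : ∀ {b} {B : Set b} {n} (g : B → List A) (f : Fin n → B) →
                            length (filter P? (concatMap g (tabulate f))) ≡ ∑[ i < n ] length (filter P? (g (f i)))
  length-filter-concatMap {n = zero}  g f = refl
  length-filter-concatMap {n = suc n} g f =
    trans (length-filter-++ (g (f zero)) _) (cong (length (filter P? (g (f zero))) +_) (length-filter-concatMap g (f ∘ suc)))

  module _ {q} {Q : Pred A q} (Q? : Decidable Q) where

    length-filter-filter : ∀ xs → length (filter Q? (filter P? xs)) ≡ length (filter (λ x → P? x ×-dec Q? x) xs)
    length-filter-filter [] = refl
    length-filter-filter (x ∷ xs) with does (P? x)
    ... | false = length-filter-filter xs
    ... | true with does (Q? x)
    ...   | true  = cong suc (length-filter-filter xs)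
    ...   | false = length-filter-filter xs

infix 4 _∈_

_∈_ : ∀ {n} → Fin n → (Fin n → Bool) → Set
v ∈ P = T (P v)

∑-mono-≤ : ∀ {n} {f g : Fin n → ℕ} → (∀ i → f i ≤ g i) → ∑[ i < n ] f i ≤ ∑[ i < n ] g i
∑-mono-≤ {zero}  f≤g = z≤n
∑-mono-≤ {suc n} f≤g = +-mono-≤ (f≤g zero) (∑-mono-≤ (f≤g ∘ suc))

term≤∑ : ∀ {n} (f : Fin n → ℕ) i → f i ≤ ∑[ j < n ] f j
term≤∑ {suc n} f i = ≤-trans (m≤m+n (f i) _) (≤-reflexive (sym (sum-remove {i = i} f)))

∑-ones : ∀ {n} {f : Fin n → ℕ} → (∀ i → f i ≡ 1) → ∑[ i < n ] f i ≡ n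
∑-ones {zero}  _    = refl
∑-ones {suc n} f≡1 = cong₂ _+_ (f≡1 zero) (∑-ones (f≡1 ∘ suc))

module _ {n : ℕ} where

  count : (Fin n → Bool) → ℕ
  count P = ∑[ v < n ] 𝟙 (P v)

  count-mono : ∀ {P Q} → (∀ {v} → v ∈ P → v ∈ Q) → count P ≤ count Q
  count-mono {P} {Q} P⊆Q = ∑-mono-≤ 𝟙-mono
    where
    𝟙-mono : ∀ v → 𝟙 (P v) ≤ 𝟙 (Q v)
    𝟙-mono v with P v | Q v | P⊆Q {v}
    ... | false | _     | _   = z≤n
    ... | true  | true  | _   = ≤-refl
    ... | true  | false | P→Q = ⊥-elim (P→Q _)

  count-∨ : ∀ P Q → count (λ v → P v ∨ Q v) ≤ count P + count Q
  count-∨ P Q = ≤-trans (∑-mono-≤ (λ v → 𝟙-∨ (P v) (Q v))) (≤-reflexive (∑-distrib-+ (𝟙 ∘ P) (𝟙 ∘ Q)))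
    where
    𝟙-∨ : ∀ a b → 𝟙 (a ∨ b) ≤ 𝟙 a + 𝟙 b
    𝟙-∨ true  b = s≤s z≤n
    𝟙-∨ false b = ≤-refl

  count-∅ : count (λ _ → false) ≡ 0
  count-∅ = sum-replicate-zero n

  count-⊤ : count (λ _ → true) ≡ n
  count-⊤ = ∑-ones (λ _ → refl)

  count-∁ : ∀ P → count (λ v → not (P v)) + count P ≡ n
  count-∁ P = trans (sym (∑-distrib-+ (λ v → 𝟙 (not (P v))) (𝟙 ∘ P))) (∑-ones (λ v → 𝟙-not (P v)))
    where
    𝟙-not : ∀ b → 𝟙 (not b) + 𝟙 b ≡ 1
    𝟙-not true  = refl
    𝟙-not false = refl

  count-witness : ∀ {P} → 0 < count P → ∃ λ v → v ∈ P
  count-witness {P} 0<count with any? (λ v → T? (P v))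
  ... | yes ∃P = ∃P
  ... | no  ∄P = contradiction (≤-trans (count-mono (λ {v} v∈P → ∄P (v , v∈P))) (≤-reflexive count-∅)) (<⇒≱ 0<count)

count-≟ : ∀ {n} (x : Fin n) → count (λ v → does (v ≟ x)) ≡ 1
count-≟ {suc n} zero    = cong suc (count-∅ {n})
count-≟ {suc n} (suc x) = count-≟ x

module GraphColouring {n : ℕ} (G : Graph n) where

  adj-sym : ∀ {v w} → T (adj G v w) → T (adj G w v)
  adj-sym {v} {w} = subst T (Graph.sym G v w)

  degree≡count : ∀ v → degree G v ≡ count (adj G v)
  degree≡count v = length-filter-tabulate (λ w → T? (adj G v w)) (λ w → w)

  induced : (Fin n → Bool) → Fin n → Fin n → Bool
  induced c i j = adj G i j ∧ c i ∧ c j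

  orientedEdge : (Fin n → Bool) → Fin n → Fin n → ℕ
  orientedEdge c i j = 𝟙 (does (toℕ i <? toℕ j) ∧ induced c i j)

  edgesWithin≡∑orientedEdge : ∀ c → edgesWithin G c ≡ ∑[ i < n ] ∑[ j < n ] orientedEdge c i j
  edgesWithin≡∑orientedEdge c = begin
    length (filter E? (filter L? (concatMap row (allFin n))))  ≡⟨ length-filter-filter L? E? (concatMap row (allFin n)) ⟩
    length (filter LE? (concatMap row (allFin n)))             ≡⟨ length-filter-concatMap LE? row (λ i → i) ⟩
    ∑[ i < n ] length (filter LE? (row i))                     ≡⟨ sum-cong-≗ (λ i → cong (length ∘ filter LE?) (map-tabulate (λ j → j) (i ,_))) ⟩
    ∑[ i < n ] length (filter LE? (tabulate (i ,_)))           ≡⟨ sum-cong-≗ (λ i → length-filter-tabulate LE? (i ,_)) ⟩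
    ∑[ i < n ] ∑[ j < n ] orientedEdge c i j                   ∎
    where
    open ≡-Reasoning
    row : Fin n → List (Fin n × Fin n)
    row i = map (i ,_) (allFin n)
    L? : Decidable {A = Fin n × Fin n} λ (i , j) → toℕ i < toℕ j
    L? (i , j) = toℕ i <? toℕ j
    E? : Decidable {A = Fin n × Fin n} λ (i , j) → T (induced c i j)
    E? (i , j) = T? (induced c i j)
    LE? : Decidable {A = Fin n × Fin n} λ (i , j) → toℕ i < toℕ j × T (induced c i j)
    LE? e = L? e ×-dec E? e

  induced-sym : ∀ c i j → induced c i j ≡ induced c j i
  induced-sym c i j = cong₂ _∧_ (Graph.sym G i j) (∧-comm (c i) (c j))

  𝟙-induced≡orientedEdges : ∀ c i j → 𝟙 (induced c i j) ≡ orientedEdge c i j + orientedEdge c j i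
  𝟙-induced≡orientedEdges c i j with <-cmp (toℕ i) (toℕ j)
  ... | tri< i<j _ j≮i rewrite dec-true (toℕ i <? toℕ j) i<j | dec-false (toℕ j <? toℕ i) j≮i =
    sym (+-identityʳ _)
  ... | tri> i≮j _ j<i rewrite dec-false (toℕ i <? toℕ j) i≮j | dec-true (toℕ j <? toℕ i) j<i =
    cong 𝟙 (induced-sym c i j)
  ... | tri≈ i≮j i≡j _ with toℕ-injective i≡j
  ...   | refl rewrite dec-false (toℕ i <? toℕ i) i≮j | irrefl G i = refl

  inducedDegree : (Fin n → Bool) → Fin n → ℕ
  inducedDegree c v = count (induced c v)

  handshake : ∀ c → ∑[ v < n ] inducedDegree c v ≡ 2 * edgesWithin G c
  handshake c = begin
    ∑[ i < n ] ∑[ j < n ] 𝟙 (induced c i j)                                 ≡⟨ sum-cong-≗ (λ i → sum-cong-≗ (𝟙-induced≡orientedEdges c i)) ⟩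
    ∑[ i < n ] ∑[ j < n ] (orientedEdge c i j + orientedEdge c j i)          ≡⟨ sum-cong-≗ (λ i → ∑-distrib-+ (orientedEdge c i) (λ j → orientedEdge c j i)) ⟩
    ∑[ i < n ] (∑[ j < n ] orientedEdge c i j + ∑[ j < n ] orientedEdge c j i) ≡⟨ ∑-distrib-+ (λ i → ∑[ j < n ] orientedEdge c i j) _ ⟩
    e + ∑[ i < n ] ∑[ j < n ] orientedEdge c j i                            ≡⟨ cong (e +_) (∑-comm (λ i j → orientedEdge c j i)) ⟩
    e + e                                                                   ≡⟨ cong (e +_) (sym (+-identityʳ e)) ⟩
    2 * e                                                                   ≡⟨ cong (2 *_) (sym (edgesWithin≡∑orientedEdge c)) ⟩
    2 * edgesWithin G c                                                     ∎
    where
    open ≡-Reasoning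
    e : ℕ
    e = ∑[ i < n ] ∑[ j < n ] orientedEdge c i j

  nonIsolated : (Fin n → Bool) → Fin n → Bool
  nonIsolated c v = ⌊ any? (λ w → T? (induced c v w)) ⌋

  nonIsolated⁺ : ∀ {c v w} → T (adj G v w) → v ∈ c → w ∈ c → v ∈ nonIsolated c
  nonIsolated⁺ {w = w} vw v∈c w∈c = fromWitness (w , from T-∧ (vw , from T-∧ (v∈c , w∈c)))

  count-nonIsolated≤2*edgesWithin : ∀ c → count (nonIsolated c) ≤ 2 * edgesWithin G c
  count-nonIsolated≤2*edgesWithin c = ≤-trans (∑-mono-≤ 𝟙-nonIsolated≤inducedDegree) (≤-reflexive (handshake c))
    where
    𝟙-nonIsolated≤inducedDegree : ∀ v → 𝟙 (nonIsolated c v) ≤ inducedDegree c v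
    𝟙-nonIsolated≤inducedDegree v with any? (λ w → T? (induced c v w))
    ... | yes (w , vw) = ≤-trans (≤-reflexive (sym (T⇒𝟙≡1 vw))) (term≤∑ (𝟙 ∘ induced c v) w)
    ... | no  _        = z≤n

  closure : (Fin n → Bool) → Fin n → Bool
  closure S v = S v ∨ ⌊ all? (λ w → T? (adj G v w) →-dec T? (S w)) ⌋

  S⊆closure : ∀ {S v} → v ∈ S → v ∈ closure S
  S⊆closure {S} {v} v∈S = from (T-∨ {S v}) (inj₁ v∈S)

  closure⁺ : ∀ {S v} → (∀ w → T (adj G v w) → w ∈ S) → v ∈ closure S
  closure⁺ {S} {v} N⊆S = from (T-∨ {S v}) (inj₂ (fromWitness N⊆S))

  closure⁻ : ∀ {S v} → v ∈ closure S → v ∈ S ⊎ (∀ w → T (adj G v w) → w ∈ S)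
  closure⁻ {S} {v} v∈R with to (T-∨ {S v}) v∈R
  ... | inj₁ v∈S = inj₁ v∈S
  ... | inj₂ N⊆S = inj₂ (toWitness N⊆S)

  ∁closure⊆nonIsolated∁ : ∀ {S v} → ¬ v ∈ closure S → v ∈ nonIsolated (λ u → not (closure S u))
  ∁closure⊆nonIsolated∁ {S} {v} v∉R with ¬∀⟶∃¬ n _ (λ w → T? (adj G v w) →-dec T? (S w)) (v∉R ∘ closure⁺)
  ... | w , ¬[vw⇒w∈S] with T? (adj G v w)
  ...   | no  ¬vw = contradiction (λ vw → contradiction vw ¬vw) ¬[vw⇒w∈S]
  ...   | yes vw  = nonIsolated⁺ vw (¬T⇒T-not v∉R) (¬T⇒T-not w∉R)
    where
    w∉R : ¬ w ∈ closure S
    w∉R w∈R with closure⁻ w∈R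
    ... | inj₁ w∈S  = ¬[vw⇒w∈S] (λ _ → w∈S)
    ... | inj₂ N⊆S = v∉R (S⊆closure (N⊆S v (adj-sym vw)))

  k≤μf-closure : ∀ k S → 2 * k ≤ count (nonIsolated (closure S)) → 2 * k + count (closure S) ≤ n →
                 k ≤ μf G (closure S)
  k≤μf-closure k S 2k≤count-nonIsolated 2k+count-R≤n = ⊓-glb (*-cancelˡ-≤ 2 red) (*-cancelˡ-≤ 2 blue)
    where
    R : Fin n → Bool
    R = closure S
    red : 2 * k ≤ 2 * redEdges G R
    red = ≤-trans 2k≤count-nonIsolated (count-nonIsolated≤2*edgesWithin R)
    2k≤count∁R : 2 * k ≤ count (λ v → not (R v))
    2k≤count∁R = +-cancelʳ-≤ (count R) (2 * k) _ (≤-trans 2k+count-R≤n (≤-reflexive (sym (count-∁ R))))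
    blue : 2 * k ≤ 2 * blueEdges G R
    blue = ≤-trans 2k≤count∁R (≤-trans (count-mono {P = λ v → not (R v)} (λ {v} v∉R → ∁closure⊆nonIsolated∁ {S} {v} (T-not⇒¬T v∉R)))
                                        (count-nonIsolated≤2*edgesWithin (λ v → not (R v))))

  module Growth (p : Fin n → Fin n) (adj-p : ∀ v → T (adj G v (p v)))
                (Δ : ℕ) (degree≤Δ : ∀ v → degree G v ≤ Δ) where

    closedNbhd : Fin n → Fin n → Bool
    closedNbhd x v = does (v ≟ x) ∨ adj G x v

    count-closedNbhd≤1+Δ : ∀ x → count (closedNbhd x) ≤ 1 + Δ
    count-closedNbhd≤1+Δ x = ≤-trans (count-∨ (λ v → does (v ≟ x)) (adj G x))
      (+-mono-≤ (≤-reflexive (count-≟ x)) (≤-trans (≤-reflexive (sym (degree≡count x))) (degree≤Δ x)))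

    N⊆S⇒nonIsolated-closure : ∀ {S v} → (∀ w → T (adj G v w) → w ∈ S) → v ∈ nonIsolated (closure S)
    N⊆S⇒nonIsolated-closure {S} {v} N⊆S =
      nonIsolated⁺ {closure S} (adj-p v) (closure⁺ N⊆S) (S⊆closure (N⊆S (p v) (adj-p v)))

    record Step (S : Fin n → Bool) (x : Fin n) (S′ : Fin n → Bool) : Set where
      field
        S′⊆S+x      : ∀ {v} → v ∈ S′ → v ∈ S ⊎ v ≡ x
        S⊆N[S+x]    : ∀ {v} → v ∈ S → (∃ λ w → T (adj G v w) × w ∈ S) ⊎ T (adj G v x)
    open Step

    closedNbhd⁺ : ∀ {x v} → v ≡ x ⊎ T (adj G v x) → v ∈ closedNbhd x
    closedNbhd⁺ {x} {v} (inj₁ refl) = from (T-∨ {does (v ≟ v)}) (inj₁ (subst T (sym (dec-true (v ≟ v) refl)) _))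
    closedNbhd⁺ {x} {v} (inj₂ v~x)  = from (T-∨ {does (v ≟ x)}) (inj₂ (adj-sym v~x))

    closure-step : ∀ {S x S′} → Step S x S′ → ∀ {v} → v ∈ closure S′ → v ∈ nonIsolated (closure S) ⊎ v ∈ closedNbhd x
    closure-step {S} {x} step {v} v∈R′ with closure⁻ v∈R′
    ... | inj₁ v∈S′ with S′⊆S+x step v∈S′
    ...   | inj₂ v≡x = inj₂ (closedNbhd⁺ (inj₁ v≡x))
    ...   | inj₁ v∈S with S⊆N[S+x] step v∈S
    ...     | inj₁ (w , vw , w∈S) = inj₁ (nonIsolated⁺ {closure S} vw (S⊆closure v∈S) (S⊆closure w∈S))
    ...     | inj₂ v~x            = inj₂ (closedNbhd⁺ (inj₂ v~x))
    closure-step {S} {x} step {v} v∈R′ | inj₂ N⊆S′ with T? (adj G v x)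
    ... | yes v~x = inj₂ (closedNbhd⁺ (inj₂ v~x))
    ... | no ¬v~x = inj₁ (N⊆S⇒nonIsolated-closure N⊆S)
      where
      N⊆S : ∀ w → T (adj G v w) → w ∈ S
      N⊆S w vw with S′⊆S+x step (N⊆S′ w vw)
      ... | inj₁ w∈S  = w∈S
      ... | inj₂ refl = contradiction vw ¬v~x

    count-closure-step : ∀ {S x S′} → Step S x S′ → count (closure S′) ≤ count (nonIsolated (closure S)) + (1 + Δ)
    count-closure-step {S} {x} step =
      ≤-trans (count-mono (λ {v} v∈R′ → from (T-∨ {nonIsolated (closure S) v}) (closure-step step v∈R′)))
      (≤-trans (count-∨ (nonIsolated (closure S)) (closedNbhd x)) (+-monoʳ-≤ _ (count-closedNbhd≤1+Δ x)))

    infixl 5 _▷_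

    data Chain : (Fin n → Bool) → Set where
      start : ∀ {S} → (∀ {v} → ¬ v ∈ S) → Chain S
      _▷_   : ∀ {S x S′} → Chain S → Step S x S′ → Chain S′

    record Crossing (K : ℕ) : Set where
      field
        S                   : Fin n → Bool
        K≤count-nonIsolated : K ≤ count (nonIsolated (closure S))
        count-closure≤K+Δ   : count (closure S) ≤ K + Δ

    first-crossing : ∀ K {S} → Chain S → K ≤ count (nonIsolated (closure S)) → Crossing K
    first-crossing K {S} (start S-empty) K≤ = record
      { S = S ; K≤count-nonIsolated = K≤ ; count-closure≤K+Δ = ≤-trans (count-mono {P = closure S} {Q = λ _ → false} R⊆∅) (≤-trans (≤-reflexive (count-∅ {n})) z≤n) }
      where
      R⊆∅ : ∀ {v} → v ∈ closure S → v ∈ (λ _ → false)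
      R⊆∅ {v} v∈R with closure⁻ v∈R
      ... | inj₁ v∈S  = S-empty v∈S
      ... | inj₂ N⊆S = S-empty (N⊆S (p v) (adj-p v))
    first-crossing K {S′} (_▷_ {S} chain step) K≤ with K ≤? count (nonIsolated (closure S))
    ... | yes K≤′ = first-crossing K chain K≤′
    ... | no  K≰  = record { S = S′ ; K≤count-nonIsolated = K≤ ; count-closure≤K+Δ = begin
      count (closure S′)                               ≤⟨ count-closure-step step ⟩
      count (nonIsolated (closure S)) + (1 + Δ)        ≡⟨ +-suc _ Δ ⟩
      suc (count (nonIsolated (closure S))) + Δ        ≤⟨ +-monoˡ-≤ Δ (≰⇒> K≰) ⟩
      K + Δ                                            ∎ }
      where open ≤-Reasoning

    seed : ℕ → ℕ → Fin n → Bool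
    seed a b v = ⌊ (toℕ v <? a) ⊎-dec any? (λ u → (toℕ u <? b) ×-dec (p u ≟ v)) ⌋

    seed⁺ : ∀ {a b v} → toℕ v < a ⊎ (∃ λ u → toℕ u < b × p u ≡ v) → v ∈ seed a b
    seed⁺ = fromWitness

    seed⁻ : ∀ {a b v} → v ∈ seed a b → toℕ v < a ⊎ (∃ λ u → toℕ u < b × p u ≡ v)
    seed⁻ = toWitness

    seed-neighbour : ∀ {a b v} → b ≤ a → v ∈ seed a b →
                     (∃ λ w → T (adj G v w) × w ∈ seed a b) ⊎ (b ≤ toℕ v × toℕ v < a)
    seed-neighbour {a} {b} {v} b≤a v∈seed with seed⁻ v∈seed
    ... | inj₂ (u , u<b , refl) = inj₁ (u , adj-sym (adj-p u) , seed⁺ (inj₁ (<-≤-trans u<b b≤a)))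
    ... | inj₁ v<a with toℕ v <? b
    ...   | yes v<b = inj₁ (p v , adj-p v , seed⁺ (inj₂ (v , v<b , refl)))
    ...   | no  v≮b = inj₂ (≮⇒≥ v≮b , v<a)

    seed-empty : ∀ {v} → ¬ v ∈ seed 0 0
    seed-empty v∈seed with seed⁻ v∈seed
    ... | inj₁ ()
    ... | inj₂ (_ , () , _)

    toℕ≡⇒≡fromℕ< : ∀ {t v} (t<n : t < n) → toℕ v ≡ t → v ≡ fromℕ< t<n
    toℕ≡⇒≡fromℕ< t<n v≡t = toℕ-injective (trans v≡t (sym (toℕ-fromℕ< t<n)))

    add-vertex : ∀ {t} (t<n : t < n) → Step (seed t t) (fromℕ< t<n) (seed (suc t) t)
    add-vertex {t} t<n = record { S′⊆S+x = grow ; S⊆N[S+x] = covered }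
      where
      grow : ∀ {v} → v ∈ seed (suc t) t → v ∈ seed t t ⊎ v ≡ fromℕ< t<n
      grow v∈seed with seed⁻ v∈seed
      ... | inj₂ partner = inj₁ (seed⁺ (inj₂ partner))
      ... | inj₁ v<1+t with m<1+n⇒m<n∨m≡n v<1+t
      ...   | inj₁ v<t = inj₁ (seed⁺ (inj₁ v<t))
      ...   | inj₂ v≡t = inj₂ (toℕ≡⇒≡fromℕ< t<n v≡t)
      covered : ∀ {v} → v ∈ seed t t → (∃ λ w → T (adj G v w) × w ∈ seed t t) ⊎ T (adj G v (fromℕ< t<n))
      covered v∈seed with seed-neighbour ≤-refl v∈seed
      ... | inj₁ neighbour    = inj₁ neighbour
      ... | inj₂ (t≤v , v<t) = contradiction v<t (≤⇒≯ t≤v)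

    add-partner : ∀ {t} (t<n : t < n) → Step (seed (suc t) t) (p (fromℕ< t<n)) (seed (suc t) (suc t))
    add-partner {t} t<n = record { S′⊆S+x = grow ; S⊆N[S+x] = covered }
      where
      grow : ∀ {v} → v ∈ seed (suc t) (suc t) → v ∈ seed (suc t) t ⊎ v ≡ p (fromℕ< t<n)
      grow v∈seed with seed⁻ v∈seed
      ... | inj₁ v<1+t = inj₁ (seed⁺ (inj₁ v<1+t))
      ... | inj₂ (u , u<1+t , pu≡v) with m<1+n⇒m<n∨m≡n u<1+t
      ...   | inj₁ u<t = inj₁ (seed⁺ (inj₂ (u , u<t , pu≡v)))
      ...   | inj₂ u≡t = inj₂ (trans (sym pu≡v) (cong p (toℕ≡⇒≡fromℕ< t<n u≡t)))
      covered : ∀ {v} → v ∈ seed (suc t) t → (∃ λ w → T (adj G v w) × w ∈ seed (suc t) t) ⊎ T (adj G v (p (fromℕ< t<n)))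
      covered {v} v∈seed with seed-neighbour (n≤1+n t) v∈seed
      ... | inj₁ neighbour      = inj₁ neighbour
      ... | inj₂ (t≤v , v<1+t) with toℕ≡⇒≡fromℕ< t<n (≤-antisym (s≤s⁻¹ v<1+t) t≤v)
      ...   | refl = inj₂ (adj-p v)

    chain-seed : ∀ t → t ≤ n → Chain (seed t t)
    chain-seed zero    _   = start seed-empty
    chain-seed (suc t) t<n = chain-seed t (<⇒≤ t<n) ▷ add-vertex t<n ▷ add-partner t<n

    crossing : ∀ K → K ≤ n → Crossing K
    crossing K K≤n = first-crossing K (chain-seed n ≤-refl) (begin
      K                                        ≤⟨ K≤n ⟩
      n                                        ≡⟨ count-⊤ {n} ⟨
      count {n} (λ _ → true)                   ≤⟨ count-mono (λ {v} _ → all-nonIsolated v) ⟩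
      count (nonIsolated (closure (seed n n))) ∎)
      where
      open ≤-Reasoning
      all-nonIsolated : ∀ v → v ∈ nonIsolated (closure (seed n n))
      all-nonIsolated v = nonIsolated⁺ {closure (seed n n)} (adj-p v)
        (S⊆closure (seed⁺ (inj₁ (toℕ<n v)))) (S⊆closure (seed⁺ (inj₂ (v , toℕ<n v , refl))))

lemma2 : (k n : ℕ) (G : Graph n) (Δ : ℕ) →
         NoIsolated G → IsMaxDegree G Δ → 2 ≤ Δ →
         5 * k ≤ n → 4 * k + Δ ≤ n →
         μ≥ G k
lemma2 k n G Δ noIsolated (degree≤Δ , _) _ _ 4k+Δ≤n =
  closure S , k≤μf-closure k S K≤count-nonIsolated (≤-trans (+-monoʳ-≤ (2 * k) count-closure≤K+Δ) 2k+[2k+Δ]≤n)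
  where
  open GraphColouring G

  neighbour : ∀ v → ∃ λ w → T (adj G v w)
  neighbour v = count-witness (subst (0 <_) (degree≡count v) (noIsolated v))

  open Growth (proj₁ ∘ neighbour) (proj₂ ∘ neighbour) Δ degree≤Δ

  2k+[2k+Δ]≤n : 2 * k + (2 * k + Δ) ≤ n
  2k+[2k+Δ]≤n = subst (_≤ n) (trans (cong (_+ Δ) (*-distribʳ-+ k 2 2)) (+-assoc (2 * k) (2 * k) Δ)) 4k+Δ≤n

  open Crossing (crossing (2 * k) (≤-trans (m≤m+n (2 * k) (2 * k + Δ)) 2k+[2k+Δ]≤n))
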